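{- Let $T$ be a Dyck tableau of size $n$, $\sigma=\phi(T)$ and a position $1\le i\le n$. We let $j=\sigma(i)$. The left border at position $i$ in $T$ is obtained by: $$ lb(i) = \left\{ \begin{array}{ll} D & \text{if } j=n; \\ D & \text{if } j+1 \text{ is to the right of } j \text{ in } \sigma;\\ U & \text{if } j+1 \text{ is to the left of } j \text{ in } \sigma. \end{array} \right. $$ The right border at position $i$ in $T$ is obtained by: $$ rb( i ) = \left\{ \begin{array}{ll} U & \text{if } j=1;\\ U & \text{if } j \text{ is to the right of } j-1 \text{ in } \sigma;\\ D & \text{if } j \text{ is to the left of } j-1 \text{ in } \sigma. \end{array} \right. $$
   Context: A Dyck tableau of size $n$ is a Dyck path of size $n$ (the staircase Ferrers diagram $E_n=(n,\dots,1)$ with the boxes of a partition $\mu\subset E_{n-1}$ removed, with $n$ columns labeled $1,\dots,n$ from left to right) in which each column contains exactly one dot. The tableau $T$ with $\phi(T)=\sigma$ is constructed from $\sigma$ as follows: start from a basement, label the columns from left to right by $\sigma(1),\dots,\sigma(n)$ and, for $j=1,\dots,n$, insert a dotted box in the column labeled $j$ and, if it is to the left of the dotted box added at step $j-1$, add a ribbon between these two boxes (a strip of boxes along the lower border linking the two dots). For a position $i$, the two steps of the lower border (Dyck path) at the bottom of column $i$ are the left border $lb(i)$ (the left one) and the right border $rb(i)$ (the right one), each equal to $D$ (down step) or $U$ (up step). -}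

module Defs where

open import Data.Nat.Base using (ℕ; zero; suc; _+_; _*_; _∸_; _<ᵇ_; _≤ᵇ_; ⌊_/2⌋)
open import Data.Nat.Properties using (_<?_)
open import Data.Bool.Base using (Bool; true; false; if_then_else_; _∧_)
open import Data.Fin.Base using (Fin; toℕ; fromℕ<)
open import Data.Fin.Permutation using (Permutation′; _⟨$⟩ʳ_; _⟨$⟩ˡ_)
open import Relation.Nullary using (yes; no)

-- Conventions (0-based positions and values).
--
-- The lower border of a Dyck tableau of size n is a lattice path of 2n
-- steps, encoded by its sequence of depths g 0 , … , g (2n)
-- (D = the depth increases, U = it decreases).  Column q (0-based)
-- sits on the steps  x=2q → 2q+1  (left border)  and  2q+1 → 2q+2
-- (right border).  Depths are shifted by one: the basement (empty
-- diagram) is the zig-zag  1,0,1,0,…,1  and the final Dyck path is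
-- g - 1 (a path from 0 to 0 staying ≥ 0).

data Step : Set where
  U D : Step

basement : ℕ → ℕ
basement zero          = 1
basement (suc zero)    = 0
basement (suc (suc x)) = basement x

-- add one layer of boxes (depth +2) on the abscissae a ≤ x ≤ b
bump : (ℕ → ℕ) → ℕ → ℕ → ℕ → ℕ
bump g a b x = if (a ≤ᵇ x) ∧ (x ≤ᵇ b) then 2 + g x else g x

-- insert a dotted box at the bottom of column q
dotBox : (ℕ → ℕ) → ℕ → ℕ → ℕ
dotBox g q = bump g (suc (2 * q)) (suc (2 * q))

-- if the new dotted box (column q) is to the left of the previous one
-- (column p), add a ribbon along the lower border between the two dots:
-- one box on every abscissa strictly between the two dots
ribbon : (ℕ → ℕ) → ℕ → ℕ → ℕ → ℕ
ribbon g q p = if q <ᵇ p then bump g (2 + 2 * q) (2 * p) else g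

-- depths of the lower border after steps 1..j of the construction,
-- where  pos v  is the column labelled v (0-based value v)
heights : (ℕ → ℕ) → ℕ → ℕ → ℕ
heights pos zero          = basement
heights pos (suc zero)    = dotBox basement (pos 0)
heights pos (suc (suc j)) =
  ribbon (dotBox (heights pos (suc j)) (pos (suc j))) (pos (suc j)) (pos j)

posOf : {n : ℕ} → Permutation′ n → ℕ → ℕ
posOf {n} σ v with v <? n
... | yes v<n = toℕ (σ ⟨$⟩ˡ fromℕ< v<n)
... | no _    = 0

stepOf : (ℕ → ℕ) → ℕ → Step
stepOf g k = if g k <ᵇ g (suc k) then D else U

-- A (raw) Dyck tableau of size n: its lower border, given as the list of
-- steps (step k goes from abscissa k to k+1, 0 ≤ k < 2n), and the dots,
-- given by the level (0 = top) of the dotted box in each column.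
record Tableau (n : ℕ) : Set where
  field
    border : ℕ → Step
    dot    : Fin n → ℕ
open Tableau public

φ⁻¹ : {n : ℕ} → Permutation′ n → Tableau n
φ⁻¹ {n} σ = record
  { border = stepOf (heights (posOf σ) n)
  ; dot    = λ q → ⌊ heights (posOf σ) (suc (toℕ (σ ⟨$⟩ʳ q))) (suc (2 * toℕ q)) ∸ 2 /2⌋
  }

lb : {n : ℕ} → Tableau n → Fin n → Step
lb T i = border T (2 * toℕ i)

rb : {n : ℕ} → Tableau n → Fin n → Step
rb T i = border T (suc (2 * toℕ i))

-- The lower border after the insertion steps is the basement raised by one layer of boxes per
-- dotted box and per ribbon, each layer covering an interval of abscissae.  Across a unit step of
-- abscissae the depth therefore changes by the zig-zag of the basement, plus the number of layers
-- starting there, minus the number of layers ending there.  At the left border of column i, whose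
-- dot is inserted at step j = σ(i), the only such layers are that dot (starting) and the ribbon of
-- step j + 1, which ends in column i exactly when j + 1 lies to the left of j.  Symmetrically, at
-- the right border they are the dot (ending) and the ribbon of step j, which starts in column i
-- exactly when j lies to the left of j - 1.  Comparing the two counts gives the sign of the step.
module Submission where

open import Defs
open import Data.Bool.Base using (true; false; if_then_else_; _∧_; T)
open import Data.Bool.Properties using (∧-zeroʳ)
open import Data.Fin.Base using (Fin; toℕ; _<_)
open import Data.Fin.Permutation using (Permutation′; _⟨$⟩ʳ_; _⟨$⟩ˡ_; inverseˡ; inverseʳ)
open import Data.Fin.Properties using (toℕ<n; toℕ-injective; fromℕ<-toℕ; toℕ-fromℕ<)
open import Data.Nat.Base using (ℕ; zero; suc; _+_; _*_; _≤_; s≤s; s≤s⁻¹; _≡ᵇ_; _<ᵇ_; _≤ᵇ_)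
import Data.Nat.Base as ℕ
open import Data.Nat.Properties
open import Data.Nat.Tactic.RingSolver using (solve-∀)
open import Function.Base using (_∘_; _$_)
open import Data.Product using (_×_; _,_)
open import Data.Sum using (inj₁; inj₂)
open import Relation.Binary.Definitions using (tri<; tri≈; tri>)
open import Relation.Binary.PropositionalEquality
open import Relation.Nullary using (yes; no; contradiction)
open import Relation.Nullary.Decidable using (dec-true; dec-false)

private
  variable
    a b k m n p q s e s′ e′ w x : ℕ
    g f f′ : ℕ → ℕ
    κ κ′ : ℕ → ℕ → ℕ

≤ᵇ-true : m ≤ n → (m ≤ᵇ n) ≡ true
≤ᵇ-true {m} {n} = dec-true (m ≤? n)

≤ᵇ-false : n ℕ.< m → (m ≤ᵇ n) ≡ false
≤ᵇ-false {n} {m} n<m = dec-false (m ≤? n) (<⇒≱ n<m)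

<ᵇ-true : m ℕ.< n → (m <ᵇ n) ≡ true
<ᵇ-true {m} {n} = dec-true (m <? n)

<ᵇ-false : n ≤ m → (m <ᵇ n) ≡ false
<ᵇ-false {n} {m} n≤m = dec-false (m <? n) (≤⇒≯ n≤m)

δ : ℕ → ℕ → ℕ
δ m n = if m ≡ᵇ n then 1 else 0

δ-refl : ∀ m → δ m m ≡ 1
δ-refl m = cong (if_then 1 else 0) (dec-true (m ≟ m) refl)

δ-≢ : m ≢ n → δ m n ≡ 0
δ-≢ {m} {n} m≢n = cong (if_then 1 else 0) (dec-false (m ≟ n) m≢n)

δ-double : ∀ m n → δ (2 * m) (2 * n) ≡ δ m n
δ-double m n with m ≟ n
... | yes refl = trans (δ-refl (2 * m)) (sym (δ-refl m))
... | no m≢n   = trans (δ-≢ (m≢n ∘ *-cancelˡ-≡ m n 2)) (sym (δ-≢ m≢n))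

δ-even-odd : ∀ m n → δ (2 * m) (suc (2 * n)) ≡ 0
δ-even-odd m n = δ-≢ (even≢odd m n)

δ-odd-even : ∀ m n → δ (suc (2 * m)) (2 * n) ≡ 0
δ-odd-even m n = δ-≢ (even≢odd n m ∘ sym)

layer : ℕ → ℕ → ℕ → ℕ
layer a b x = if (a ≤ᵇ x) ∧ (x ≤ᵇ b) then 2 else 0

bump≡layer+ : ∀ g a b x → bump g a b x ≡ layer a b x + g x
bump≡layer+ g a b x with (a ≤ᵇ x) ∧ (x ≤ᵇ b)
... | true  = refl
... | false = refl

layer-inside : a ≤ x → x ≤ b → layer a b x ≡ 2
layer-inside a≤x x≤b rewrite ≤ᵇ-true a≤x | ≤ᵇ-true x≤b = refl

layer-below : ∀ b → x ℕ.< a → layer a b x ≡ 0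
layer-below b x<a rewrite ≤ᵇ-false x<a = refl

layer-above : ∀ a → b ℕ.< x → layer a b x ≡ 0
layer-above {x = x} a b<x rewrite ≤ᵇ-false b<x = cong (if_then 2 else 0) (∧-zeroʳ (a ≤ᵇ x))

private
  compare-values : ∀ {l c d f l′ c′ d′ f′} → l ≡ c → d ≡ f → l′ ≡ c′ → d′ ≡ f′ →
                   c + 2 * f ≡ c′ + 2 * f′ → l + 2 * d ≡ l′ + 2 * d′
  compare-values refl refl refl refl eq = eq

-- The discrete derivative of the indicator of [a, b], with its negative part moved to the left.
layer-suc : a ≤ suc b → ∀ x → layer a b (suc x) + 2 * δ x b ≡ layer a b x + 2 * δ (suc x) a
layer-suc {a} {b} a≤1+b x with <-cmp x b | <-cmp (suc x) a
... | tri< _ x≢b _ | tri< 1+x<a _ _ = compare-values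
    (layer-below b 1+x<a) (δ-≢ x≢b)
    (layer-below b (<-trans (n<1+n x) 1+x<a)) (δ-≢ (<⇒≢ 1+x<a)) refl
... | tri< x<b x≢b _ | tri≈ _ refl _ = compare-values
    (layer-inside ≤-refl x<b) (δ-≢ x≢b)
    (layer-below b (n<1+n x)) (δ-refl (suc x)) refl
... | tri< x<b x≢b _ | tri> _ _ a<1+x = compare-values
    (layer-inside (<⇒≤ a<1+x) x<b) (δ-≢ x≢b)
    (layer-inside (s≤s⁻¹ a<1+x) (<⇒≤ x<b)) (δ-≢ (>⇒≢ a<1+x)) refl
... | tri≈ _ refl _ | tri< 1+x<a _ _ = contradiction a≤1+b (<⇒≱ 1+x<a)
... | tri≈ _ refl _ | tri≈ _ refl _ = compare-values
    (layer-above a (n<1+n x)) (δ-refl x)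
    (layer-below b (n<1+n x)) (δ-refl (suc x)) refl
... | tri≈ _ refl _ | tri> _ _ a<1+x = compare-values
    (layer-above a (n<1+n x)) (δ-refl x)
    (layer-inside (s≤s⁻¹ a<1+x) ≤-refl) (δ-≢ (>⇒≢ a<1+x)) refl
... | tri> _ _ b<x | tri< 1+x<a _ _ = contradiction a≤1+b (<⇒≱ (<-trans (s≤s b<x) 1+x<a))
... | tri> _ _ b<x | tri≈ _ refl _ = contradiction a≤1+b (<⇒≱ (s≤s b<x))
... | tri> _ x≢b b<x | tri> _ _ a<1+x = compare-values
    (layer-above a (<-trans b<x (n<1+n x))) (δ-≢ x≢b)
    (layer-above a b<x) (δ-≢ (>⇒≢ a<1+x)) refl

-- Crossing from abscissa x to x + 1 the depth of g changes by the number s of layers starting at x + 1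
-- minus the number e of layers ending at x, on top of the zig-zag of the basement.
record Slope (g : ℕ → ℕ) (x s e : ℕ) : Set where
  constructor slope
  field balance : 2 * e + basement x + g (suc x) ≡ 2 * s + basement (suc x) + g x

slope-resp : Slope g x s e → s ≡ s′ → e ≡ e′ → Slope g x s′ e′
slope-resp h refl refl = h

slope-bump : a ≤ suc b → Slope g x s e → Slope (bump g a b) x (s + δ (suc x) a) (e + δ x b)
slope-bump {a} {b} {g} {x} {s} {e} a≤1+b (slope h) = slope $ begin
  2 * (e + δ x b) + basement x + bump g a b (suc x)
    ≡⟨ cong (2 * (e + δ x b) + basement x +_) (bump≡layer+ g a b (suc x)) ⟩
  2 * (e + δ x b) + basement x + (layer a b (suc x) + g (suc x))
    ≡⟨ regroup e (δ x b) (basement x) (layer a b (suc x)) (g (suc x)) ⟩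
  (2 * e + basement x + g (suc x)) + (layer a b (suc x) + 2 * δ x b)
    ≡⟨ cong₂ _+_ h (layer-suc a≤1+b x) ⟩
  (2 * s + basement (suc x) + g x) + (layer a b x + 2 * δ (suc x) a)
    ≡⟨ sym (regroup s (δ (suc x) a) (basement (suc x)) (layer a b x) (g x)) ⟩
  2 * (s + δ (suc x) a) + basement (suc x) + (layer a b x + g x)
    ≡⟨ cong (2 * (s + δ (suc x) a) + basement (suc x) +_) (sym (bump≡layer+ g a b x)) ⟩
  2 * (s + δ (suc x) a) + basement (suc x) + bump g a b x ∎
  where
  open ≡-Reasoning
  regroup : ∀ e d c l h → 2 * (e + d) + c + (l + h) ≡ (2 * e + c + h) + (l + 2 * d)
  regroup = solve-∀

ribbon-nonempty : q ℕ.< p → 2 + 2 * q ≤ suc (2 * p)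
ribbon-nonempty {q} {p} q<p = m≤n⇒m≤1+n (subst (_≤ 2 * p) (*-suc 2 q) (*-monoʳ-≤ 2 q<p))

ribbonCount : (ℕ → ℕ → ℕ) → ℕ → ℕ → ℕ
ribbonCount κ q p = if q <ᵇ p then κ q p else 0

slope-ribbon : ∀ q p → Slope g x s e →
  Slope (ribbon g q p) x (s + ribbonCount (λ q p → δ (suc x) (2 + 2 * q)) q p)
                         (e + ribbonCount (λ q p → δ x (2 * p)) q p)
slope-ribbon {s = s} {e} q p h with q <ᵇ p in q<ᵇp
... | true  = slope-bump (ribbon-nonempty (<ᵇ⇒< q p (subst T (sym q<ᵇp) _))) h
... | false = slope-resp h (sym (+-identityʳ s)) (sym (+-identityʳ e))

sumBelow : ℕ → (ℕ → ℕ) → ℕ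
sumBelow zero    f = 0
sumBelow (suc k) f = sumBelow k f + f k

sumBelow-cong : ∀ k → (∀ j → f j ≡ f′ j) → sumBelow k f ≡ sumBelow k f′
sumBelow-cong zero    eq = refl
sumBelow-cong (suc k) eq = cong₂ _+_ (sumBelow-cong k eq) (eq k)

sumBelow-vanish : ∀ k → (∀ j → j ℕ.< k → f j ≡ 0) → sumBelow k f ≡ 0
sumBelow-vanish zero    z = refl
sumBelow-vanish (suc k) z =
  cong₂ _+_ (sumBelow-vanish k (λ j j<k → z j (m<n⇒m<1+n j<k))) (z k (n<1+n k))

sumBelow-single : w ℕ.< k → (∀ j → j ℕ.< k → j ≢ w → f j ≡ 0) → sumBelow k f ≡ f w
sumBelow-single {w} {suc k} {f} w<1+k z with m<1+n⇒m<n∨m≡n w<1+k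
... | inj₁ w<k  = trans (cong₂ _+_ (sumBelow-single w<k (λ j j<k → z j (m<n⇒m<1+n j<k)))
                                   (z k (n<1+n k) (>⇒≢ w<k)))
                        (+-identityʳ (f w))
... | inj₂ refl = cong (_+ f w) (sumBelow-vanish w (λ j j<w → z j (m<n⇒m<1+n j<w) (<⇒≢ j<w)))

ribbonCount-vanish : ∀ κ q p → κ q p ≡ 0 → ribbonCount κ q p ≡ 0
ribbonCount-vanish κ q p z with q <ᵇ p
... | true  = z
... | false = refl

ribbonAt : (ℕ → ℕ → ℕ) → (ℕ → ℕ) → ℕ → ℕ
ribbonAt κ pos zero    = 0
ribbonAt κ pos (suc j) = ribbonCount κ (pos (suc j)) (pos j)

ribbonAt-cong : ∀ pos → (∀ q p → κ q p ≡ κ′ q p) → ∀ m → ribbonAt κ pos m ≡ ribbonAt κ′ pos m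
ribbonAt-cong pos eq zero    = refl
ribbonAt-cong pos eq (suc j) = cong (if pos (suc j) <ᵇ pos j then_else 0) (eq (pos (suc j)) (pos j))

ribbonAt-vanish : ∀ pos → (∀ q p → κ q p ≡ 0) → ∀ m → ribbonAt κ pos m ≡ 0
ribbonAt-vanish pos z zero    = refl
ribbonAt-vanish {κ} pos z (suc j) =
  ribbonCount-vanish κ (pos (suc j)) (pos j) (z (pos (suc j)) (pos j))

layerCount : (ℕ → ℕ) → (ℕ → ℕ → ℕ) → ℕ → ℕ
layerCount pos ι k = sumBelow k (λ m → ι (suc (2 * pos m)) (suc (2 * pos m)))
                   + sumBelow k (ribbonAt (λ q p → ι (2 + 2 * q) (2 * p)) pos)

layerCount-suc : ∀ pos ι k → layerCount pos ι (suc k) ≡ layerCount pos ι k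
  + ι (suc (2 * pos k)) (suc (2 * pos k)) + ribbonAt (λ q p → ι (2 + 2 * q) (2 * p)) pos k
layerCount-suc pos ι k = interleave (sumBelow k _) _ (sumBelow k _) _
  where
  interleave : ∀ d d′ r r′ → d + d′ + (r + r′) ≡ d + r + d′ + r′
  interleave = solve-∀

heights-slope : ∀ pos x k →
  Slope (heights pos k) x (layerCount pos (λ a _ → δ (suc x) a) k) (layerCount pos (λ _ b → δ x b) k)
heights-slope pos x zero          = slope (+-comm (basement x) (basement (suc x)))
heights-slope pos x (suc zero)    =
  slope-resp (slope-bump (n≤1+n _) (heights-slope pos x zero))
    (sym (+-identityʳ _)) (sym (+-identityʳ _))
heights-slope pos x (suc (suc j)) =
  slope-resp
    (slope-ribbon (pos (suc j)) (pos j) (slope-bump (n≤1+n _) (heights-slope pos x (suc j))))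
    (sym (layerCount-suc pos (λ a _ → δ (suc x) a) (suc j)))
    (sym (layerCount-suc pos (λ _ b → δ x b) (suc j)))

dotsIn : (ℕ → ℕ) → ℕ → ℕ → ℕ
dotsIn pos q k = sumBelow k (λ m → δ q (pos m))

ribbonsEndingIn : (ℕ → ℕ) → ℕ → ℕ → ℕ
ribbonsEndingIn pos q k = sumBelow k (ribbonAt (λ _ p → δ q p) pos)

ribbonsStartingIn : (ℕ → ℕ) → ℕ → ℕ → ℕ
ribbonsStartingIn pos q k = sumBelow k (ribbonAt (λ q′ _ → δ q q′) pos)

left-border-slope : ∀ pos q k →
  Slope (heights pos k) (2 * q) (dotsIn pos q k) (ribbonsEndingIn pos q k)
left-border-slope pos q k = slope-resp (heights-slope pos (2 * q) k)
  (trans (cong₂ _+_ (sumBelow-cong k (λ m → δ-double q (pos m)))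
                    (sumBelow-vanish k (λ m _ → ribbonAt-vanish pos (λ q′ _ → δ-even-odd q q′) m)))
         (+-identityʳ _))
  (cong₂ _+_ (sumBelow-vanish k (λ m _ → δ-even-odd q (pos m)))
             (sumBelow-cong k (ribbonAt-cong pos (λ _ p → δ-double q p))))

right-border-slope : ∀ pos q k →
  Slope (heights pos k) (suc (2 * q)) (ribbonsStartingIn pos q k) (dotsIn pos q k)
right-border-slope pos q k = slope-resp (heights-slope pos (suc (2 * q)) k)
  (cong₂ _+_ (sumBelow-vanish k (λ m _ → δ-odd-even q (pos m)))
             (sumBelow-cong k (ribbonAt-cong pos (λ q′ _ → δ-double q q′))))
  (trans (cong₂ _+_ (sumBelow-cong k (λ m → δ-double q (pos m)))
                    (sumBelow-vanish k (λ m _ → ribbonAt-vanish pos (λ _ p → δ-odd-even q p) m)))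
         (+-identityʳ _))

basement-even : ∀ q → basement (2 * q) ≡ 1
basement-even zero    = refl
basement-even (suc q) rewrite *-suc 2 q = basement-even q

basement-odd : ∀ q → basement (suc (2 * q)) ≡ 0
basement-odd zero    = refl
basement-odd (suc q) = subst (λ y → basement (suc y) ≡ 0) (sym (*-suc 2 q)) (basement-odd q)

stepOf-D : g (suc k) ≡ suc (g k) → stepOf g k ≡ D
stepOf-D {g} {k} eq rewrite eq = cong (if_then D else U) (<ᵇ-true (n<1+n (g k)))

stepOf-U : g k ≡ suc (g (suc k)) → stepOf g k ≡ U
stepOf-U {g} {k} eq rewrite eq = cong (if_then D else U) (<ᵇ-false (n≤1+n (g (suc k))))

even-slope : Slope g (2 * q) s e → 2 * e + 1 + g (suc (2 * q)) ≡ 2 * s + 0 + g (2 * q)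
even-slope {g = g} {q = q} {s = s} {e = e} (slope h) =
  subst₂ (λ b b′ → 2 * e + b + g (suc (2 * q)) ≡ 2 * s + b′ + g (2 * q))
         (basement-even q) (basement-odd q) h

odd-slope : Slope g (suc (2 * q)) s e → 2 * e + 0 + g (2 + 2 * q) ≡ 2 * s + 1 + g (suc (2 * q))
odd-slope {g = g} {q = q} {s = s} {e = e} (slope h) =
  subst₂ (λ b b′ → 2 * e + b + g (2 + 2 * q) ≡ 2 * s + b′ + g (suc (2 * q)))
         (basement-odd q) (basement-even q) h

stepOf-even-D : ∀ q → Slope g (2 * q) 1 0 → stepOf g (2 * q) ≡ D
stepOf-even-D {g} q h =
  stepOf-D {g} {2 * q} (suc-injective (even-slope {q = q} h))

stepOf-even-U : ∀ q → Slope g (2 * q) 1 1 → stepOf g (2 * q) ≡ U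
stepOf-even-U {g} q h =
  stepOf-U {g} {2 * q} (sym (suc-injective (suc-injective (even-slope {q = q} h))))

stepOf-odd-U : ∀ q → Slope g (suc (2 * q)) 0 1 → stepOf g (suc (2 * q)) ≡ U
stepOf-odd-U {g} q h =
  stepOf-U {g} {suc (2 * q)} (sym (suc-injective (odd-slope {q = q} h)))

stepOf-odd-D : ∀ q → Slope g (suc (2 * q)) 1 1 → stepOf g (suc (2 * q)) ≡ D
stepOf-odd-D {g} q h =
  stepOf-D {g} {suc (2 * q)} (suc-injective (suc-injective (odd-slope {q = q} h)))

module ColumnCounts (pos : ℕ → ℕ) (n q v : ℕ) (v<n : v ℕ.< n) (pos-v : pos v ≡ q)
                    (pos-unique : ∀ m → m ℕ.< n → pos m ≡ q → m ≡ v) where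

  δ-pos : ∀ m → m ℕ.< n → m ≢ v → δ q (pos m) ≡ 0
  δ-pos m m<n m≢v = δ-≢ (m≢v ∘ pos-unique m m<n ∘ sym)

  dotsIn≡1 : dotsIn pos q n ≡ 1
  dotsIn≡1 = trans (sumBelow-single v<n δ-pos) (trans (cong (δ q) pos-v) (δ-refl q))

  ending-vanishes : ∀ j → j ℕ.< n → j ≢ suc v → ribbonAt (λ _ p → δ q p) pos j ≡ 0
  ending-vanishes zero    _   _      = refl
  ending-vanishes (suc j) j<n j≢1+v =
    ribbonCount-vanish (λ _ p → δ q p) (pos (suc j)) (pos j)
      (δ-pos j (<-trans (n<1+n j) j<n) (j≢1+v ∘ cong suc))

  starting-vanishes : ∀ j → j ℕ.< n → j ≢ v → ribbonAt (λ q′ _ → δ q q′) pos j ≡ 0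
  starting-vanishes zero    _   _   = refl
  starting-vanishes (suc j) j<n j≢v =
    ribbonCount-vanish (λ q′ _ → δ q q′) (pos (suc j)) (pos j) (δ-pos (suc j) j<n j≢v)

  ribbonsEndingIn-last : suc v ≡ n → ribbonsEndingIn pos q n ≡ 0
  ribbonsEndingIn-last refl = sumBelow-vanish n (λ j j<n → ending-vanishes j j<n (<⇒≢ j<n))

  ribbonsEndingIn-next : suc v ℕ.< n → ribbonsEndingIn pos q n ≡ (if pos (suc v) <ᵇ q then 1 else 0)
  ribbonsEndingIn-next 1+v<n
    rewrite sumBelow-single 1+v<n ending-vanishes | pos-v | δ-refl q = refl

  ribbonsStartingIn-first : v ≡ 0 → ribbonsStartingIn pos q n ≡ 0
  ribbonsStartingIn-first v≡0 rewrite sumBelow-single v<n starting-vanishes | v≡0 = refl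

  ribbonsStartingIn-prev : ∀ u → v ≡ suc u → ribbonsStartingIn pos q n ≡ (if q <ᵇ pos u then 1 else 0)
  ribbonsStartingIn-prev u v≡1+u
    rewrite sumBelow-single v<n starting-vanishes | v≡1+u | pos-v | δ-refl q = refl

posOf-toℕ : (σ : Permutation′ n) (j : Fin n) → posOf σ (toℕ j) ≡ toℕ (σ ⟨$⟩ˡ j)
posOf-toℕ {n} σ j with toℕ j <? n
... | yes j<n = cong (λ k → toℕ (σ ⟨$⟩ˡ k)) (fromℕ<-toℕ j j<n)
... | no  j≮n = contradiction (toℕ<n j) j≮n

posOf-unique : (σ : Permutation′ n) (i : Fin n) →
               ∀ m → m ℕ.< n → posOf σ m ≡ toℕ i → m ≡ toℕ (σ ⟨$⟩ʳ i)
posOf-unique {n} σ i m m<n eq with m <? n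
... | yes m<n′ = trans (sym (toℕ-fromℕ< m<n′))
                       (cong toℕ (trans (sym (inverseʳ σ)) (cong (σ ⟨$⟩ʳ_) (toℕ-injective eq))))
... | no  m≮n = contradiction m<n m≮n

indicator-< : m ℕ.< n → (if m <ᵇ n then 1 else 0) ≡ 1
indicator-< m<n = cong (if_then 1 else 0) (<ᵇ-true m<n)

indicator-≥ : n ≤ m → (if m <ᵇ n then 1 else 0) ≡ 0
indicator-≥ n≤m = cong (if_then 1 else 0) (<ᵇ-false n≤m)

module Borders (σ : Permutation′ n) (i : Fin n) where

  open ColumnCounts (posOf σ) n (toℕ i) (toℕ (σ ⟨$⟩ʳ i)) (toℕ<n (σ ⟨$⟩ʳ i))
                    (trans (posOf-toℕ σ (σ ⟨$⟩ʳ i)) (cong toℕ (inverseˡ σ))) (posOf-unique σ i)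
    public

  lb-D : ribbonsEndingIn (posOf σ) (toℕ i) n ≡ 0 → lb (φ⁻¹ σ) i ≡ D
  lb-D ends≡0 = stepOf-even-D (toℕ i)
    (slope-resp (left-border-slope (posOf σ) (toℕ i) n) dotsIn≡1 ends≡0)

  lb-U : ribbonsEndingIn (posOf σ) (toℕ i) n ≡ 1 → lb (φ⁻¹ σ) i ≡ U
  lb-U ends≡1 = stepOf-even-U (toℕ i)
    (slope-resp (left-border-slope (posOf σ) (toℕ i) n) dotsIn≡1 ends≡1)

  rb-U : ribbonsStartingIn (posOf σ) (toℕ i) n ≡ 0 → rb (φ⁻¹ σ) i ≡ U
  rb-U starts≡0 = stepOf-odd-U (toℕ i)
    (slope-resp (right-border-slope (posOf σ) (toℕ i) n) starts≡0 dotsIn≡1)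

  rb-D : ribbonsStartingIn (posOf σ) (toℕ i) n ≡ 1 → rb (φ⁻¹ σ) i ≡ D
  rb-D starts≡1 = stepOf-odd-D (toℕ i)
    (slope-resp (right-border-slope (posOf σ) (toℕ i) n) starts≡1 dotsIn≡1)

  ribbonsEndingIn-successor : (j : Fin n) → toℕ j ≡ suc (toℕ (σ ⟨$⟩ʳ i)) →
    ribbonsEndingIn (posOf σ) (toℕ i) n ≡ (if toℕ (σ ⟨$⟩ˡ j) <ᵇ toℕ i then 1 else 0)
  ribbonsEndingIn-successor j j≡1+v rewrite sym (posOf-toℕ σ j) | j≡1+v =
    ribbonsEndingIn-next (subst (ℕ._< n) j≡1+v (toℕ<n j))

  ribbonsStartingIn-predecessor : (j : Fin n) → suc (toℕ j) ≡ toℕ (σ ⟨$⟩ʳ i) →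
    ribbonsStartingIn (posOf σ) (toℕ i) n ≡ (if toℕ i <ᵇ toℕ (σ ⟨$⟩ˡ j) then 1 else 0)
  ribbonsStartingIn-predecessor j 1+j≡v rewrite sym (posOf-toℕ σ j) =
    ribbonsStartingIn-prev (toℕ j) (sym 1+j≡v)

proposition11 : (n : ℕ) (T : Tableau n) (σ : Permutation′ n) → φ⁻¹ σ ≡ T →
    (i : Fin n) →
    ((suc (toℕ (σ ⟨$⟩ʳ i)) ≡ n → lb T i ≡ D)
    × ((j' : Fin n) → toℕ j' ≡ suc (toℕ (σ ⟨$⟩ʳ i)) →
    (i < σ ⟨$⟩ˡ j' → lb T i ≡ D) × (σ ⟨$⟩ˡ j' < i → lb T i ≡ U)))
    × ((toℕ (σ ⟨$⟩ʳ i) ≡ 0 → rb T i ≡ U)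
    × ((j' : Fin n) → suc (toℕ j') ≡ toℕ (σ ⟨$⟩ʳ i) →
    (σ ⟨$⟩ˡ j' < i → rb T i ≡ U) × (i < σ ⟨$⟩ˡ j' → rb T i ≡ D)))
proposition11 n .(φ⁻¹ σ) σ refl i =
    ( (λ last → lb-D (ribbonsEndingIn-last last))
    , λ j j≡1+v →
        (λ i<j → lb-D (trans (ribbonsEndingIn-successor j j≡1+v) (indicator-≥ (<⇒≤ i<j))))
      , (λ j<i → lb-U (trans (ribbonsEndingIn-successor j j≡1+v) (indicator-< j<i))) )
  , ( (λ first → rb-U (ribbonsStartingIn-first first))
    , λ j 1+j≡v →
        (λ j<i → rb-U (trans (ribbonsStartingIn-predecessor j 1+j≡v) (indicator-≥ (<⇒≤ j<i))))
      , (λ i<j → rb-D (trans (ribbonsStartingIn-predecessor j 1+j≡v) (indicator-< i<j))) )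
  where open Borders σ i
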